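{- Let $q$ be any prime power. For every $\beta\in\mathbb{F}_q$, $$\delta(2,q;\beta)\le\begin{cases}2q-4,&\text{if }\mathrm{char}\,\mathbb{F}_q\neq2,\\2q-3,&\text{if }\mathrm{char}\,\mathbb{F}_q=2.\end{cases}$$
   Context: $\delta(2,q;\beta)=|\{(\alpha_1,\alpha_2)\in(\mathbb{F}_q^*)^2:\alpha_1+\alpha_1^{ -1}+\alpha_2+\alpha_2^{ -1}=\beta\}|$. -}

module Defs where

open import Level using (Level; suc; _⊔_)
open import Data.Nat using (ℕ)
open import Data.Product using (_×_; _,_)
open import Data.List using (List; length; filter; cartesianProduct)
open import Data.List.Relation.Unary.Any using (Any)
open import Data.List.Relation.Unary.AllPairs using (AllPairs)
open import Relation.Nullary using (¬_; Dec)
open import Relation.Nullary.Decidable using (¬?)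
open import Relation.Binary using (Decidable)
open import Algebra.Bundles using (CommutativeRing)

record FiniteField (c ℓ : Level) : Set (suc (c ⊔ ℓ)) where
  field
    commRing : CommutativeRing c ℓ
  open CommutativeRing commRing public
  field
    _≟_     : Decidable _≈_
    0≉1     : ¬ (0# ≈ 1#)
    _⁻¹     : Carrier → Carrier
    ⁻¹-inverse : ∀ x → ¬ (x ≈ 0#) → (x * (x ⁻¹)) ≈ 1#
    elements : List Carrier
    complete : ∀ x → Any (x ≈_) elements
    distinct : AllPairs (λ a b → ¬ (a ≈ b)) elements

module _ {c ℓ : Level} (F : FiniteField c ℓ) where
  open FiniteField F

  order : ℕ
  order = length elements

  char2 : Set ℓ
  char2 = (1# + 1#) ≈ 0#

  units : List Carrier
  units = filter (λ x → ¬? (x ≟ 0#)) elements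

  δ₂ : Carrier → ℕ
  δ₂ β = length (filter (λ p → Pair-eq p) (cartesianProduct units units))
    where
    Pair-eq : (p : Carrier × Carrier) → Dec _
    Pair-eq (a₁ , a₂) = (((a₁ + (a₁ ⁻¹)) + a₂) + (a₂ ⁻¹)) ≟ β

{-# OPTIONS --safe #-}
module Submission where

-- Write φ(x) = x + x⁻¹, so that δ(2,q;β) = Σ_{x ∈ F*} N(x) with N(x) the
-- number of y ∈ F* such that φ(y) = β − φ(x). Since φ(y) = φ(z) forces
-- z = y or z = y⁻¹, every N(x) ≤ 2, giving δ ≤ 2(q − 1). For a square root
-- t of unity, φ(y) = φ(t) forces y = t; so either N(t) = 0, or some b with
-- φ(t) + φ(b) = β has N(b) ≤ 1. Each case loses at least 1 from the bound
-- 2(q − 1). In odd characteristic t = 1 and t = −1 do so at different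
-- places, since φ(1) ≠ φ(−1).

open import Defs
open import Level using (Level; _⊔_)
open import Data.Nat using (ℕ; suc; _≤_; _∸_; z≤n; s≤s)
open import Data.Nat.ListAction using (sum)
open import Data.Product using (_×_; _,_; proj₁)
open import Data.Sum using (_⊎_; inj₁; inj₂)
open import Data.Empty using (⊥; ⊥-elim)
open import Data.List using (List; []; _∷_; _++_; length; map; filter; cartesianProduct)
open import Data.List.Properties using (length-++; length-map; filter-++; filter-accept; filter-reject; filter-all; filter-none)
open import Data.List.Relation.Unary.All as All using (All; []; _∷_)
open import Data.List.Relation.Unary.All.Properties using (all-filter)
open import Data.List.Relation.Unary.All.Properties.Core using (¬Any⇒All¬; All¬⇒¬Any)
open import Data.List.Relation.Unary.Any as Any using (Any; here; there; any?)
open import Data.List.Relation.Unary.Any.Properties using (lookup-result)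
open import Data.List.Relation.Unary.AllPairs using (AllPairs; []; _∷_)
open import Function using (_∘_)
open import Relation.Binary.PropositionalEquality as ≡ using (_≡_; cong; cong₂; subst; module ≡-Reasoning)
open import Relation.Nullary using (¬_; yes; no)
open import Relation.Nullary.Decidable using (¬?)
open import Relation.Unary using (Pred; Decidable)

import Data.List.Relation.Unary.All.Properties as AllP
import Data.List.Relation.Unary.Any.Properties as AnyP
import Data.List.Relation.Unary.AllPairs.Properties as AllPairsP

module _ {a p} {A : Set a} {P : Pred A p} (P? : Decidable P) where

  filter-map : ∀ {b} {B : Set b} (f : B → A) xs →
               filter P? (map f xs) ≡ map f (filter (P? ∘ f) xs)
  filter-map f []       = ≡.refl
  filter-map f (x ∷ xs) with P? (f x)
  ... | yes _ = cong (f x ∷_) (filter-map f xs)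
  ... | no _  = filter-map f xs

  length-filter-map : ∀ {b} {B : Set b} (f : B → A) xs →
                      length (filter P? (map f xs)) ≡ length (filter (P? ∘ f) xs)
  length-filter-map f xs =
    ≡.trans (cong length (filter-map f xs)) (length-map f (filter (P? ∘ f) xs))

module _ {a b p} {A : Set a} {B : Set b} {P : Pred (A × B) p} (P? : Decidable P) where
  open import Data.Nat using (_+_)
  open ≡-Reasoning

  length-filter-cartesianProduct :
    ∀ xs ys → length (filter P? (cartesianProduct xs ys))
              ≡ sum (map (λ x → length (filter (λ y → P? (x , y)) ys)) xs)
  length-filter-cartesianProduct []       ys = ≡.refl
  length-filter-cartesianProduct (x ∷ xs) ys = begin
    length (filter P? (map (x ,_) ys ++ cartesianProduct xs ys))
      ≡⟨ cong length (filter-++ P? (map (x ,_) ys) (cartesianProduct xs ys)) ⟩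
    length (filter P? (map (x ,_) ys) ++ filter P? (cartesianProduct xs ys))
      ≡⟨ length-++ (filter P? (map (x ,_) ys)) ⟩
    length (filter P? (map (x ,_) ys)) + length (filter P? (cartesianProduct xs ys))
      ≡⟨ cong₂ _+_ (length-filter-map P? (x ,_) ys) (length-filter-cartesianProduct xs ys) ⟩
    length (filter (λ y → P? (x , y)) ys) + sum (map (λ x → length (filter (λ y → P? (x , y)) ys)) xs)
      ∎

module _ {a} {A : Set a} (g : A → ℕ) where
  open import Data.Nat using (_+_; _*_)
  open import Data.Nat.Properties
    using (+-comm; +-commutativeSemigroup; *-suc; *-zeroʳ; ≤-trans; m≤m+n; m≤n+m; +-mono-≤; +-monoʳ-≤; m+[n∸m]≡n; m+n≤o⇒m≤o∸n; module ≤-Reasoning)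
  open import Algebra.Properties.CommutativeSemigroup +-commutativeSemigroup using (interchange)

  sum+sum∸≡*length : ∀ {k xs} → All (λ x → g x ≤ k) xs →
                     sum (map g xs) + sum (map (λ x → k ∸ g x) xs) ≡ k * length xs
  sum+sum∸≡*length {k} []                       = ≡.sym (*-zeroʳ k)
  sum+sum∸≡*length {k} {x ∷ xs} (gx≤k ∷ gxs≤k) = begin
    (g x + sum (map g xs)) + ((k ∸ g x) + sum (map (λ x → k ∸ g x) xs))
      ≡⟨ interchange (g x) _ (k ∸ g x) _ ⟩
    (g x + (k ∸ g x)) + (sum (map g xs) + sum (map (λ x → k ∸ g x) xs))
      ≡⟨ cong₂ _+_ (m+[n∸m]≡n gx≤k) (sum+sum∸≡*length gxs≤k) ⟩
    k + k * length xs
      ≡⟨ *-suc k (length xs) ⟨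
    k * suc (length xs)
      ∎
    where open ≡-Reasoning

  sum≤*length∸ : ∀ {k d xs} → All (λ x → g x ≤ k) xs → d ≤ sum (map (λ x → k ∸ g x) xs) →
                 sum (map g xs) ≤ k * length xs ∸ d
  sum≤*length∸ {k} {d} {xs} g≤k d≤ = m+n≤o⇒m≤o∸n (sum (map g xs)) (begin
    sum (map g xs) + d                                  ≤⟨ +-monoʳ-≤ (sum (map g xs)) d≤ ⟩
    sum (map g xs) + sum (map (λ x → k ∸ g x) xs)       ≡⟨ sum+sum∸≡*length g≤k ⟩
    k * length xs                                       ∎)
    where open ≤-Reasoning

  Any-≤⇒≤sum : ∀ {m xs} → Any (λ x → m ≤ g x) xs → m ≤ sum (map g xs)
  Any-≤⇒≤sum {xs = x ∷ xs} (here m≤gx) = ≤-trans m≤gx (m≤m+n (g x) _)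
  Any-≤⇒≤sum {xs = x ∷ xs} (there p)   = ≤-trans (Any-≤⇒≤sum p) (m≤n+m _ (g x))

  Any-≤-disjoint⇒+≤sum : ∀ {p q} {P : Pred A p} {Q : Pred A q} {m n xs} → (∀ {x} → P x → Q x → ⊥) →
                         Any (λ x → m ≤ g x × P x) xs → Any (λ x → n ≤ g x × Q x) xs →
                         m + n ≤ sum (map g xs)
  Any-≤-disjoint⇒+≤sum P∩Q=∅ (here (_ , Px))    (here (_ , Qx))    = ⊥-elim (P∩Q=∅ Px Qx)
  Any-≤-disjoint⇒+≤sum P∩Q=∅ (here (m≤gx , _))  (there q)          =
    +-mono-≤ m≤gx (Any-≤⇒≤sum (Any.map proj₁ q))
  Any-≤-disjoint⇒+≤sum {m = m} {n} {x ∷ xs} P∩Q=∅ (there p) (here (n≤gx , _)) =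
    subst (_≤ g x + sum (map g xs)) (+-comm n m) (+-mono-≤ n≤gx (Any-≤⇒≤sum (Any.map proj₁ p)))
  Any-≤-disjoint⇒+≤sum {xs = x ∷ _} P∩Q=∅ (there p) (there q) =
    ≤-trans (Any-≤-disjoint⇒+≤sum P∩Q=∅ p q) (m≤n+m _ (g x))

module FieldProperties {c ℓ} (F : FiniteField c ℓ) where
  open FiniteField F
  open import Algebra.Properties.Ring ring
    using (-‿distribˡ-*; -1*x≈-x; -‿involutive; +-cancelʳ; x∙y⁻¹≈ε⇒x≈y)
  open import Relation.Binary.Reasoning.Setoid setoid

  ⁻¹-inverseˡ : ∀ x → ¬ x ≈ 0# → x ⁻¹ * x ≈ 1#
  ⁻¹-inverseˡ x x≉0 = trans (*-comm (x ⁻¹) x) (⁻¹-inverse x x≉0)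

  *-cancelˡ : ∀ x y z → ¬ x ≈ 0# → x * y ≈ x * z → y ≈ z
  *-cancelˡ x y z x≉0 xy≈xz = begin
    y               ≈⟨ *-identityˡ y ⟨
    1# * y          ≈⟨ *-congʳ (⁻¹-inverseˡ x x≉0) ⟨
    (x ⁻¹ * x) * y  ≈⟨ *-assoc (x ⁻¹) x y ⟩
    x ⁻¹ * (x * y)  ≈⟨ *-congˡ xy≈xz ⟩
    x ⁻¹ * (x * z)  ≈⟨ *-assoc (x ⁻¹) x z ⟨
    (x ⁻¹ * x) * z  ≈⟨ *-congʳ (⁻¹-inverseˡ x x≉0) ⟩
    1# * z          ≈⟨ *-identityˡ z ⟩
    z               ∎

  ⁻¹-cong : ∀ {x y} → ¬ x ≈ 0# → x ≈ y → x ⁻¹ ≈ y ⁻¹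
  ⁻¹-cong {x} {y} x≉0 x≈y = *-cancelˡ y (x ⁻¹) (y ⁻¹) y≉0 (begin
    y * x ⁻¹  ≈⟨ *-congʳ x≈y ⟨
    x * x ⁻¹  ≈⟨ ⁻¹-inverse x x≉0 ⟩
    1#        ≈⟨ ⁻¹-inverse y y≉0 ⟨
    y * y ⁻¹  ∎)
    where
    y≉0 : ¬ y ≈ 0#
    y≉0 y≈0 = x≉0 (trans x≈y y≈0)

  square≈1⇒≉0 : ∀ {t} → t * t ≈ 1# → ¬ t ≈ 0#
  square≈1⇒≉0 {t} t²≈1 t≈0 = 0≉1 (begin
    0#      ≈⟨ zeroˡ t ⟨
    0# * t  ≈⟨ *-congʳ t≈0 ⟨
    t * t   ≈⟨ t²≈1 ⟩
    1#      ∎)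

  -1²≈1 : - 1# * - 1# ≈ 1#
  -1²≈1 = trans (-1*x≈-x (- 1#)) (-‿involutive 1#)

  x-y+[y+z]≈x+z : ∀ x y z → (x - y) + (y + z) ≈ x + z
  x-y+[y+z]≈x+z x y z = begin
    (x - y) + (y + z)    ≈⟨ +-assoc x (- y) (y + z) ⟩
    x + (- y + (y + z))  ≈⟨ +-congˡ (+-assoc (- y) y z) ⟨
    x + ((- y + y) + z)  ≈⟨ +-congˡ (+-congʳ (-‿inverseˡ y)) ⟩
    x + (0# + z)         ≈⟨ +-congˡ (+-identityˡ z) ⟩
    x + z                ∎

  +≈+⇒-≈- : ∀ u v w z → u + w ≈ v + z → u - v ≈ z - w
  +≈+⇒-≈- u v w z u+w≈v+z = +-cancelʳ (v + w) (u - v) (z - w) (begin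
    (u - v) + (v + w)  ≈⟨ x-y+[y+z]≈x+z u v w ⟩
    u + w              ≈⟨ u+w≈v+z ⟩
    v + z              ≈⟨ +-comm v z ⟩
    z + v              ≈⟨ x-y+[y+z]≈x+z z w v ⟨
    (z - w) + (w + v)  ≈⟨ +-congˡ (+-comm w v) ⟩
    (z - w) + (v + w)  ∎)

  φ : Carrier → Carrier
  φ x = x + x ⁻¹

  φ-cong : ∀ {x y} → ¬ x ≈ 0# → x ≈ y → φ x ≈ φ y
  φ-cong x≉0 x≈y = +-cong x≈y (⁻¹-cong x≉0 x≈y)

  φx*[x*y]≈x*[x*y]+y : ∀ x y → ¬ x ≈ 0# → φ x * (x * y) ≈ x * (x * y) + y
  φx*[x*y]≈x*[x*y]+y x y x≉0 = begin
    (x + x ⁻¹) * (x * y)          ≈⟨ distribʳ (x * y) x (x ⁻¹) ⟩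
    x * (x * y) + x ⁻¹ * (x * y)  ≈⟨ +-congˡ (*-assoc (x ⁻¹) x y) ⟨
    x * (x * y) + x ⁻¹ * x * y    ≈⟨ +-congˡ (*-congʳ (⁻¹-inverseˡ x x≉0)) ⟩
    x * (x * y) + 1# * y          ≈⟨ +-congˡ (*-identityˡ y) ⟩
    x * (x * y) + y               ∎

  -- (x − y)·xy = x − y, read off from φ(x)·xy = φ(y)·xy.
  φ≈φ⇒≈⊎*≈1 : ∀ {x y} → ¬ x ≈ 0# → ¬ y ≈ 0# → φ x ≈ φ y → x ≈ y ⊎ x * y ≈ 1#
  φ≈φ⇒≈⊎*≈1 {x} {y} x≉0 y≉0 φx≈φy with x ≟ y
  ... | yes x≈y = inj₁ x≈y
  ... | no  x≉y = inj₂ (*-cancelˡ (x - y) (x * y) 1# x-y≉0 (begin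
    (x - y) * (x * y)            ≈⟨ distribʳ (x * y) x (- y) ⟩
    x * (x * y) + - y * (x * y)  ≈⟨ +-congˡ (-‿distribˡ-* y (x * y)) ⟨
    x * (x * y) - y * (x * y)    ≈⟨ +≈+⇒-≈- _ _ _ _ cross ⟩
    x - y                        ≈⟨ *-identityʳ (x - y) ⟨
    (x - y) * 1#                 ∎))
    where
    x-y≉0 : ¬ x - y ≈ 0#
    x-y≉0 x-y≈0 = x≉y (x∙y⁻¹≈ε⇒x≈y x y x-y≈0)

    cross : x * (x * y) + y ≈ y * (x * y) + x
    cross = begin
      x * (x * y) + y  ≈⟨ φx*[x*y]≈x*[x*y]+y x y x≉0 ⟨
      φ x * (x * y)    ≈⟨ *-congʳ φx≈φy ⟩
      φ y * (x * y)    ≈⟨ *-congˡ (*-comm x y) ⟩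
      φ y * (y * x)    ≈⟨ φx*[x*y]≈x*[x*y]+y y x y≉0 ⟩
      y * (y * x) + x  ≈⟨ +-congʳ (*-congˡ (*-comm y x)) ⟩
      y * (x * y) + x  ∎

  φ≈φ-square≈1⇒≈ : ∀ {y t} → t * t ≈ 1# → ¬ y ≈ 0# → φ y ≈ φ t → y ≈ t
  φ≈φ-square≈1⇒≈ {y} {t} t²≈1 y≉0 φy≈φt with φ≈φ⇒≈⊎*≈1 y≉0 (square≈1⇒≉0 t²≈1) φy≈φt
  ... | inj₁ y≈t  = y≈t
  ... | inj₂ yt≈1 = begin
    y            ≈⟨ *-identityʳ y ⟨
    y * 1#       ≈⟨ *-congˡ t²≈1 ⟨
    y * (t * t)  ≈⟨ *-assoc y t t ⟨
    (y * t) * t  ≈⟨ *-congʳ yt≈1 ⟩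
    1# * t       ≈⟨ *-identityˡ t ⟩
    t            ∎

  -1≈1⇒char2 : - 1# ≈ 1# → char2 F
  -1≈1⇒char2 -1≈1 = trans (+-congˡ (sym -1≈1)) (-‿inverseʳ 1#)

  φ1≈φ-1⇒char2 : φ 1# ≈ φ (- 1#) → char2 F
  φ1≈φ-1⇒char2 φ1≈φ-1
    with φ≈φ⇒≈⊎*≈1 (square≈1⇒≉0 (*-identityˡ 1#)) (square≈1⇒≉0 -1²≈1) φ1≈φ-1
  ... | inj₁ 1≈-1  = -1≈1⇒char2 (sym 1≈-1)
  ... | inj₂ 1*-1≈1 = -1≈1⇒char2 (trans (sym (*-identityˡ (- 1#))) 1*-1≈1)

module ElementLists {c ℓ} (F : FiniteField c ℓ) where
  open FiniteField F
  open FieldProperties F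

  Distinct : List Carrier → Set (c ⊔ ℓ)
  Distinct = AllPairs (λ x y → ¬ x ≈ y)

  Distinct-All≈⇒length≤1 : ∀ {t xs} → Distinct xs → All (_≈ t) xs → length xs ≤ 1
  Distinct-All≈⇒length≤1 {xs = []}        _                  _                 = z≤n
  Distinct-All≈⇒length≤1 {xs = _ ∷ []}    _                  _                 = s≤s z≤n
  Distinct-All≈⇒length≤1 {xs = _ ∷ _ ∷ _} ((x≉y ∷ _) ∷ _) (x≈t ∷ y≈t ∷ _) = ⊥-elim (x≉y (trans x≈t (sym y≈t)))

  φ-fibre-length≤2 : ∀ {v xs} → Distinct xs → All (λ y → ¬ y ≈ 0#) xs → All (λ y → φ y ≈ v) xs →
                     length xs ≤ 2
  φ-fibre-length≤2 {xs = []}            _ _ _ = z≤n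
  φ-fibre-length≤2 {xs = _ ∷ []}        _ _ _ = s≤s z≤n
  φ-fibre-length≤2 {xs = _ ∷ _ ∷ []}    _ _ _ = s≤s (s≤s z≤n)
  φ-fibre-length≤2 {xs = x ∷ y ∷ z ∷ _}
    ((x≉y ∷ x≉z ∷ _) ∷ (y≉z ∷ _) ∷ _) (x≉0 ∷ y≉0 ∷ z≉0 ∷ _) (φx≈v ∷ φy≈v ∷ φz≈v ∷ _)
    with φ≈φ⇒≈⊎*≈1 x≉0 y≉0 (trans φx≈v (sym φy≈v)) | φ≈φ⇒≈⊎*≈1 x≉0 z≉0 (trans φx≈v (sym φz≈v))
  ... | inj₁ x≈y  | _         = ⊥-elim (x≉y x≈y)
  ... | inj₂ _    | inj₁ x≈z  = ⊥-elim (x≉z x≈z)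
  ... | inj₂ xy≈1 | inj₂ xz≈1 = ⊥-elim (y≉z (*-cancelˡ x y z x≉0 (trans xy≈1 (sym xz≈1))))

  length≡suc-length-filter≉ : ∀ {a xs} → Distinct xs → Any (a ≈_) xs →
                              length xs ≡ suc (length (filter (λ x → ¬? (x ≟ a)) xs))
  length≡suc-length-filter≉ {a} {x ∷ xs} (x∉xs ∷ _) (here a≈x) = cong suc (begin
    length xs                    ≡⟨ cong length (filter-all ≉a? xs≉a) ⟨
    length (filter ≉a? xs)       ≡⟨ cong length (filter-reject ≉a? (λ x≉a → x≉a (sym a≈x))) ⟨
    length (filter ≉a? (x ∷ xs)) ∎)
    where
    open ≡-Reasoning
    ≉a? = λ x → ¬? (x ≟ a)
    xs≉a : All (λ y → ¬ y ≈ a) xs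
    xs≉a = All.map (λ x≉y y≈a → x≉y (trans (sym a≈x) (sym y≈a))) x∉xs
  length≡suc-length-filter≉ {a} {x ∷ xs} (x∉xs ∷ xs!) (there a∈xs) =
    cong suc (≡.trans (length≡suc-length-filter≉ xs! a∈xs) (cong length (≡.sym (filter-accept ≉a? x≉a))))
    where
    ≉a? = λ x → ¬? (x ≟ a)
    x≉a : ¬ x ≈ a
    x≉a x≈a = All¬⇒¬Any x∉xs (Any.map (trans x≈a) a∈xs)

  units-nonzero : All (λ x → ¬ x ≈ 0#) (units F)
  units-nonzero = all-filter (λ x → ¬? (x ≟ 0#)) elements

  units-distinct : Distinct (units F)
  units-distinct = AllPairsP.filter⁺ (λ x → ¬? (x ≟ 0#)) distinct

  ∈units : ∀ {x} → ¬ x ≈ 0# → Any (x ≈_) (units F)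
  ∈units {x} x≉0 with AnyP.filter⁺ (λ x → ¬? (x ≟ 0#)) (complete x)
  ... | inj₁ x∈units = x∈units
  ... | inj₂ ¬y≉0    = ⊥-elim (¬y≉0 (λ y≈0 → x≉0 (trans (lookup-result (complete x)) y≈0)))

  order≡suc-length-units : order F ≡ suc (length (units F))
  order≡suc-length-units = length≡suc-length-filter≉ distinct (complete 0#)

module SolutionCounts {c ℓ} (F : FiniteField c ℓ) (β : FiniteField.Carrier F) where
  open FiniteField F
  open FieldProperties F
  open ElementLists F
  open import Algebra.Properties.Ring ring using (x≈z//y; +-cancelˡ; +-cancelʳ)
  open import Data.Nat.Properties using (≤-refl; ≤-trans; ∸-monoʳ-≤)

  -- Spelled exactly as in δ₂, so that δ₂≡sum-solutionCount holds by unfolding.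
  solutions : Carrier → List Carrier
  solutions x = filter (λ y → (((x + x ⁻¹) + y) + y ⁻¹) ≟ β) (units F)

  solutionCount : Carrier → ℕ
  solutionCount x = length (solutions x)

  deficit : Carrier → ℕ
  deficit x = 2 ∸ solutionCount x

  δ₂≡sum-solutionCount : δ₂ F β ≡ sum (map solutionCount (units F))
  δ₂≡sum-solutionCount = length-filter-cartesianProduct _ (units F) (units F)

  x+x⁻¹+y+y⁻¹≈φx+φy : ∀ x y → ((x + x ⁻¹) + y) + y ⁻¹ ≈ φ x + φ y
  x+x⁻¹+y+y⁻¹≈φx+φy x y = +-assoc (φ x) y (y ⁻¹)

  solutions-φ : ∀ x → All (λ y → φ x + φ y ≈ β) (solutions x)
  solutions-φ x = All.map (trans (sym (x+x⁻¹+y+y⁻¹≈φx+φy x _))) (all-filter _ (units F))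

  solutions-distinct : ∀ x → Distinct (solutions x)
  solutions-distinct x = AllPairsP.filter⁺ _ units-distinct

  solutions-nonzero : ∀ x → All (λ y → ¬ y ≈ 0#) (solutions x)
  solutions-nonzero x = AllP.filter⁺ _ units-nonzero

  solutionCount≤2 : ∀ x → solutionCount x ≤ 2
  solutionCount≤2 x = φ-fibre-length≤2 (solutions-distinct x) (solutions-nonzero x)
    (All.map (λ φx+φy≈β → x≈z//y _ _ β (trans (+-comm _ (φ x)) φx+φy≈β)) (solutions-φ x))

  solutionCount≤1 : ∀ {t b} → t * t ≈ 1# → φ t + φ b ≈ β → solutionCount b ≤ 1
  solutionCount≤1 {t} {b} t²≈1 φt+φb≈β = Distinct-All≈⇒length≤1 (solutions-distinct b)
    (All.zipWith (λ (y≉0 , φb+φy≈β) → φ≈φ-square≈1⇒≈ t²≈1 y≉0 (+-cancelˡ (φ b) _ _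
      (trans φb+φy≈β (trans (sym φt+φb≈β) (+-comm (φ t) (φ b))))))
      (solutions-nonzero b , solutions-φ b))

  solutions≡[] : ∀ {t u} → ¬ t ≈ 0# → t ≈ u → All (λ b → ¬ φ t + φ b ≈ β) (units F) → solutions u ≡ []
  solutions≡[] t≉0 t≈u no-b = filter-none _ (All.map (λ φt+φb≉β e →
    φt+φb≉β (trans (+-congʳ (φ-cong t≉0 t≈u)) (trans (sym (x+x⁻¹+y+y⁻¹≈φx+φy _ _)) e))) no-b)

  deficit-near-square-root-of-1 : ∀ {t} → t * t ≈ 1# →
    Any (λ x → 2 ≤ deficit x) (units F) ⊎ Any (λ b → 1 ≤ deficit b × φ t + φ b ≈ β) (units F)
  deficit-near-square-root-of-1 {t} t²≈1 with any? (λ b → (φ t + φ b) ≟ β) (units F)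
  ... | yes some-b = inj₂ (Any.map (λ e → ∸-monoʳ-≤ 2 (solutionCount≤1 t²≈1 e) , e) some-b)
  ... | no  no-b   = inj₁ (Any.map (λ t≈u → subst (λ l → 2 ≤ 2 ∸ length l)
                                                   (≡.sym (solutions≡[] t≉0 t≈u (¬Any⇒All¬ _ no-b))) ≤-refl)
                                    (∈units t≉0))
    where t≉0 = square≈1⇒≉0 t²≈1

  sum-deficit≥1 : 1 ≤ sum (map deficit (units F))
  sum-deficit≥1 with deficit-near-square-root-of-1 (*-identityˡ 1#)
  ... | inj₁ two = ≤-trans (s≤s z≤n) (Any-≤⇒≤sum deficit two)
  ... | inj₂ one = Any-≤⇒≤sum deficit (Any.map proj₁ one)

  sum-deficit≥2 : ¬ char2 F → 2 ≤ sum (map deficit (units F))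
  sum-deficit≥2 ¬char2
    with deficit-near-square-root-of-1 (*-identityˡ 1#) | deficit-near-square-root-of-1 -1²≈1
  ... | inj₁ two  | _         = Any-≤⇒≤sum deficit two
  ... | inj₂ _    | inj₁ two  = Any-≤⇒≤sum deficit two
  ... | inj₂ one₊ | inj₂ one₋ = Any-≤-disjoint⇒+≤sum deficit one₊∩one₋=∅ one₊ one₋
    where
    one₊∩one₋=∅ : ∀ {b} → φ 1# + φ b ≈ β → φ (- 1#) + φ b ≈ β → ⊥
    one₊∩one₋=∅ {b} e₊ e₋ = ¬char2 (φ1≈φ-1⇒char2 (+-cancelʳ (φ b) _ _ (trans e₊ (sym e₋))))

-- ℕ's _+_ and _*_ are opened only from here on: the modules above use the field's.
open import Data.Nat using (_+_; _*_)
open import Data.Nat.Properties using (*-suc; module ≤-Reasoning)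

lemma8 : {c ℓ : Level} (F : FiniteField c ℓ) (β : FiniteField.Carrier F) →
    ((¬ char2 F) → δ₂ F β ≤ 2 * order F ∸ 4)
    × (char2 F → δ₂ F β ≤ 2 * order F ∸ 3)
lemma8 F β = (λ ¬char2 → δ₂≤2*order∸[2+d] (sum-deficit≥2 ¬char2)) , (λ _ → δ₂≤2*order∸[2+d] sum-deficit≥1)
  where
  open SolutionCounts F β
  open ElementLists F using (order≡suc-length-units)
  open ≤-Reasoning

  δ₂≤2*order∸[2+d] : ∀ {d} → d ≤ sum (map deficit (units F)) → δ₂ F β ≤ 2 * order F ∸ (2 + d)
  δ₂≤2*order∸[2+d] {d} d≤ = begin
    δ₂ F β                             ≡⟨ δ₂≡sum-solutionCount ⟩
    sum (map solutionCount (units F))  ≤⟨ sum≤*length∸ solutionCount (All.universal solutionCount≤2 (units F)) d≤ ⟩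
    2 * length (units F) ∸ d           ≡⟨ cong (_∸ (2 + d)) 2*order≡2+2*length ⟨
    2 * order F ∸ (2 + d)              ∎
    where
    2*order≡2+2*length : 2 * order F ≡ 2 + 2 * length (units F)
    2*order≡2+2*length = ≡.trans (cong (2 *_) order≡suc-length-units) (*-suc 2 (length (units F)))
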